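{- Let $T\in[0\mathinner{.\,.}\sigma)^n$. If $T[i\mathinner{.\,.} i+2\ell)$ is a p-square and $\overrightarrow{T}[i+\ell]=\overrightarrow{T}[i+2\ell]$, then $T[i+1\mathinner{.\,.} i+2\ell]$ is a p-square. Similarly, if $T[i\mathinner{.\,.} i+2\ell)$ is a p-square and $\overleftarrow{T}[i-1]=\overleftarrow{T}[i+\ell-1]$, then $T[i-1\mathinner{.\,.} i+2\ell-1)$ is a p-square.
   Context: $T[i\mathinner{.\,.} j]=T[i\mathinner{.\,.} j+1)=T[i]\cdots T[j]$; $X^R$ is the reverse of $X$; $\mathrm{alph}(X)$ the set of letters of $X$. Two strings $X,Y$ parameterized match if $|X|=|Y|$ and there is a bijection $f:\mathrm{alph}(X)\to\mathrm{alph}(Y)$ with $f(X[i])=Y[i]$ for all $i$; a p-square is a string $XY$ with $|X|=|Y|$ such that $X$ and $Y$ parameterized match. For a nonempty string $X$, $\mathbf{E}(X)=|\mathrm{alph}(U)|$ where $U$ is the longest suffix of $X[1\mathinner{.\,.}|X|)$ not containing the letter $X[|X|]$. Strings $\overrightarrow{T},\overleftarrow{T}$ of length $n$ are defined by $\overrightarrow{T}[i]=\mathbf{E}(T[1\mathinner{.\,.} i])$ and $\overleftarrow{T}[i]=\mathbf{E}((T[i\mathinner{.\,.} n])^R)$. -}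

module Defs where

open import Data.Nat using (ℕ; zero; suc; _+_; _∸_)
open import Data.Fin using (Fin)
open import Data.Fin.Properties using (_≟_)
open import Data.List using (List; []; _∷_; _++_; length; take; drop; reverse; takeWhile; deduplicate)
open import Data.List.Membership.Propositional using (_∈_)
open import Data.List.Relation.Binary.Pointwise using (Pointwise)
open import Data.Vec using (Vec; toList)
open import Data.Product using (Σ; _×_; ∃)
open import Relation.Binary.PropositionalEquality using (_≡_)
open import Relation.Nullary using (¬?)

-- Parameterized match: |X| = |Y| and a bijection f : alph(X) → alph(Y)
-- with f(X[k]) = Y[k] for all k.  The bijection is represented as a
-- function on letters that is injective on alph(X); surjectivity onto
-- alph(Y) is then automatic from f(X[k]) = Y[k].
PMatch : {σ : ℕ} → List (Fin σ) → List (Fin σ) → Set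
PMatch {σ} X Y =
  length X ≡ length Y ×
  Σ (Fin σ → Fin σ) λ f →
    (∀ a b → a ∈ X → b ∈ X → f a ≡ f b → a ≡ b) ×
    Pointwise (λ x y → f x ≡ y) X Y

PSquare : {σ : ℕ} → List (Fin σ) → Set
PSquare {σ} S = Σ (List (Fin σ)) λ X → Σ (List (Fin σ)) λ Y →
  S ≡ X ++ Y × length X ≡ length Y × PMatch X Y

alphSize : {σ : ℕ} → List (Fin σ) → ℕ
alphSize X = length (deduplicate _≟_ X)

-- E(X) = |alph(U)|, U the longest suffix of X[1..|X|) not containing X[|X|].
-- Computed on the reversal: reverse X = c ∷ rest, reverse U = takeWhile (≠ c) rest.
-- (E of the empty string is set to 0; it is never used.)
Erev : {σ : ℕ} → List (Fin σ) → ℕ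
Erev [] = 0
Erev (c ∷ rest) = alphSize (takeWhile (λ a → ¬? (a ≟ c)) rest)

E : {σ : ℕ} → List (Fin σ) → ℕ
E X = Erev (reverse X)

-- 1-based fragment T[a .. b) = T[a] ⋯ T[b-1]  (for 1 ≤ a ≤ b).
fac : {σ : ℕ} → List (Fin σ) → ℕ → ℕ → List (Fin σ)
fac T a b = take (b ∸ a) (drop (a ∸ 1) T)

-- →T[i] = E(T[1..i])  (1-based, 1 ≤ i ≤ n)
arrowR : {σ n : ℕ} → Vec (Fin σ) n → ℕ → ℕ
arrowR T i = E (fac (toList T) 1 (i + 1))

-- ←T[i] = E((T[i..n])^R)  (1-based, 1 ≤ i ≤ n)
arrowL : {σ n : ℕ} → Vec (Fin σ) n → ℕ → ℕ
arrowL {n = n} T i = E (reverse (fac (toList T) i (n + 1)))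

-- Write the p-square as X Y with Y = map f X for a renaming f that is injective on the letters of X.
-- Shifting the square by one position removes a letter from each half, which keeps them matching,
-- and adds a letter c to X and d to Y; the extended halves match iff either c occurs in X and
-- f c = d, or c is new to X and d is new to Y.  E decides which: E at c counts the distinct letters
-- since the previous c.  If c occurs in X, this count equals the count at f c in Y, and distinct
-- letters occurring in a string have distinct counts, so E(c) = E(d) forces f c = d.  If c is new
-- to X, its count is at least |alph X|, whereas a d occurring in Y would have a count below
-- |alph Y| = |alph X|.  For →T the counts look back over the halves, so the argument runs on the
-- reversed halves; for ←T they look forward.

module Submission where

open import Data.Fin using (Fin)
open import Data.Fin.Properties using (_≟_)
open import Data.List using (List; []; _∷_; [_]; _++_; _ʳ++_; length; map; take; drop; reverse; takeWhile; deduplicate)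
open import Data.List.Properties
  using (++-assoc; ++-identityʳ; ++-ʳ++; ʳ++-defn; unfold-reverse; reverse-involutive; reverse-map; map-++; map-id;
         map-cong-local; length-map; length-++; length-++-sucʳ; length-drop; drop-drop; take-all; take-[]; ∷-injective)
open import Data.List.Membership.Propositional using (_∈_; _∉_)
open import Data.List.Membership.Propositional.Properties
  using (∈-++⁺ˡ; ∈-++⁺ʳ; ∈-++⁻; ∈-map⁺; ∈-map⁻; ∈-∃++; ∈-deduplicate⁺; ∈-deduplicate⁻)
open import Data.List.Relation.Binary.Subset.Propositional using (_⊆_)
open import Data.List.Relation.Binary.Pointwise using (Pointwise; []; _∷_; Pointwise-≡⇒≡; map⁺)
open import Data.List.Relation.Unary.All as All using (All; []; _∷_)
import Data.List.Relation.Unary.All.Properties as Allₚ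
open import Data.List.Relation.Unary.Any using (here; there; any?)
open import Data.List.Relation.Unary.Any.Properties using (reverse⁻)
open import Data.List.Relation.Unary.AllPairs using ([]; _∷_)
open import Data.List.Relation.Unary.Unique.Propositional using (Unique)
open import Data.List.Relation.Unary.Unique.DecPropositional.Properties using (deduplicate-!)
open import Data.Nat using (ℕ; zero; suc; _+_; _∸_; _≤_; _<_; s≤s; z≤n; ⌊_/2⌋)
open import Data.Nat.Properties
  using (≤-trans; ≤-reflexive; <-irrefl; ≤-antisym; suc-injective;
         ≤-pred; +-comm; +-assoc; m+n∸m≡n; m≤n⇒∃[o]m+o≡n; n≡⌊n+n/2⌋; m+n≤o⇒m≤o∸n;
         module ≤-Reasoning)
open import Data.Nat.Tactic.RingSolver using (solve-∀)
open import Data.Product using (Σ; ∃₂; _×_; _,_; proj₁; proj₂)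
open import Data.Sum using (inj₁; inj₂)
open import Data.Vec using (Vec; toList)
open import Data.Vec.Properties using (length-toList)
open import Data.Vec.Functional using (updateAt)
open import Data.Vec.Functional.Properties using (updateAt-updates; updateAt-minimal)
open import Function using (_∘_; id)
open import Relation.Binary.PropositionalEquality
  using (_≡_; _≢_; refl; sym; trans; cong; cong₂; subst; subst₂; module ≡-Reasoning)
open import Relation.Nullary using (¬_; ¬?; yes; no; contradiction)
open import Relation.Nullary.Decidable using (dec-true; dec-false)
open import Relation.Unary using (Decidable)

open import Defs

private
  variable
    A B : Set
    σ : ℕ

++-cancel-length : (xs ys : List A) {xs′ ys′ : List A} → length xs ≡ length ys →
                   xs ++ xs′ ≡ ys ++ ys′ → xs ≡ ys × xs′ ≡ ys′
++-cancel-length []       []       _       eq = refl , eq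
++-cancel-length (x ∷ xs) (y ∷ ys) |xs|≡|ys| eq with refl , eq′ ← ∷-injective eq
  with refl , rest ← ++-cancel-length xs ys (suc-injective |xs|≡|ys|) eq′ = refl , rest

take-++ : (xs : List A) {m : ℕ} (k : ℕ) (ys : List A) → length xs ≡ m →
          take (m + k) (xs ++ ys) ≡ xs ++ take k ys
take-++ []       k ys refl = refl
take-++ (x ∷ xs) k ys refl = cong (x ∷_) (take-++ xs k ys refl)

take-length-++ : (xs : List A) {m : ℕ} (ys : List A) → length xs ≡ m → take m (xs ++ ys) ≡ xs
take-length-++ []       ys refl = refl
take-length-++ (x ∷ xs) ys refl = cong (x ∷_) (take-length-++ xs ys refl)

drop-length-++ : (xs : List A) {m : ℕ} (ys : List A) → length xs ≡ m → drop m (xs ++ ys) ≡ ys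
drop-length-++ []       ys refl = refl
drop-length-++ (x ∷ xs) ys refl = drop-length-++ xs ys refl

take-+ : (m k : ℕ) (xs : List A) → take (m + k) xs ≡ take m xs ++ take k (drop m xs)
take-+ zero    k xs       = refl
take-+ (suc m) k []       = sym (take-[] k)
take-+ (suc m) k (x ∷ xs) = cong (x ∷_) (take-+ m k xs)

drop-suc : (k : ℕ) (xs : List A) → drop (suc k) xs ≡ drop 1 (drop k xs)
drop-suc zero    xs       = refl
drop-suc (suc k) []       = refl
drop-suc (suc k) (x ∷ xs) = drop-suc k xs

splitAt-length : (l : ℕ) {m : ℕ} (xs : List A) → length xs ≡ l + m →
                 ∃₂ λ ys zs → xs ≡ ys ++ zs × length ys ≡ l × length zs ≡ m
splitAt-length zero    xs       eq = [] , xs , refl , refl , eq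
splitAt-length (suc l) (x ∷ xs) eq with ys , zs , refl , |ys| , |zs| ← splitAt-length l xs (suc-injective eq) =
  x ∷ ys , zs , refl , cong suc |ys| , |zs|

Unique⇒length≤ : {xs ys : List A} → Unique xs → xs ⊆ ys → length xs ≤ length ys
Unique⇒length≤ {xs = []}     _            _     = z≤n
Unique⇒length≤ {xs = x ∷ xs} (x∉xs ∷ uxs) x∷xs⊆ys
  with ys₁ , ys₂ , refl ← ∈-∃++ (x∷xs⊆ys (here refl)) =
  ≤-trans (s≤s (Unique⇒length≤ uxs xs⊆ys₁++ys₂)) (≤-reflexive (sym (length-++-sucʳ ys₁ x ys₂)))
  where
  xs⊆ys₁++ys₂ : xs ⊆ ys₁ ++ ys₂
  xs⊆ys₁++ys₂ {z} z∈xs with ∈-++⁻ ys₁ (x∷xs⊆ys (there z∈xs))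
  ... | inj₁ z∈ys₁         = ∈-++⁺ˡ z∈ys₁
  ... | inj₂ (here refl)   = contradiction refl (All.lookup x∉xs z∈xs)
  ... | inj₂ (there z∈ys₂) = ∈-++⁺ʳ ys₁ z∈ys₂

takeWhile-++ : {P : A → Set} (P? : Decidable P) {xs : List A} (ys : List A) →
               All P xs → takeWhile P? (xs ++ ys) ≡ xs ++ takeWhile P? ys
takeWhile-++ P? ys []                       = refl
takeWhile-++ P? ys (_∷_ {x} {xs} px pxs) rewrite dec-true (P? x) px = cong (x ∷_) (takeWhile-++ P? ys pxs)

takeWhile-¬ : {P : A → Set} (P? : Decidable P) {x : A} (xs : List A) → ¬ P x → takeWhile P? (x ∷ xs) ≡ []
takeWhile-¬ P? {x} xs ¬px rewrite dec-false (P? x) ¬px = refl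

InjectiveOn : (A → B) → List A → Set
InjectiveOn f xs = ∀ x y → x ∈ xs → y ∈ xs → f x ≡ f y → x ≡ y

InjectiveOn-⊆ : {f : A → B} {xs ys : List A} → xs ⊆ ys → InjectiveOn f ys → InjectiveOn f xs
InjectiveOn-⊆ xs⊆ys inj x y x∈ y∈ = inj x y (xs⊆ys x∈) (xs⊆ys y∈)

InjectiveOn-∷ : {f : A → B} {x : A} {xs : List A} → InjectiveOn f xs → f x ∉ map f xs → InjectiveOn f (x ∷ xs)
InjectiveOn-∷ {f = f} {xs = xs} inj fx∉fxs = λ where
  _ _ (here refl) (here refl) _     → refl
  _ _ (here refl) (there y∈)  fx≡fy → contradiction (subst (_∈ map f xs) (sym fx≡fy) (∈-map⁺ f y∈)) fx∉fxs
  _ _ (there x∈)  (here refl) fx≡fy → contradiction (subst (_∈ map f xs) fx≡fy (∈-map⁺ f x∈)) fx∉fxs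
  x y (there x∈)  (there y∈)  fx≡fy → inj x y x∈ y∈ fx≡fy

Unique-map⁺ : {f : A → B} {xs : List A} → InjectiveOn f xs → Unique xs → Unique (map f xs)
Unique-map⁺ inj []           = []
Unique-map⁺ inj (x∉xs ∷ uxs) =
  Allₚ.map⁺ (All.tabulate λ y∈ fx≡fy → All.lookup x∉xs y∈ (inj _ _ (here refl) (there y∈) fx≡fy))
  ∷ Unique-map⁺ (InjectiveOn-⊆ there inj) uxs

alphSize-mono : {X Y : List (Fin σ)} → X ⊆ Y → alphSize X ≤ alphSize Y
alphSize-mono {X = X} X⊆Y =
  Unique⇒length≤ (deduplicate-! _≟_ X) (∈-deduplicate⁺ _≟_ ∘ X⊆Y ∘ ∈-deduplicate⁻ _≟_ X)

alphSize-strict : {X Y : List (Fin σ)} {y : Fin σ} → X ⊆ Y → y ∈ Y → y ∉ X → alphSize X < alphSize Y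
alphSize-strict {X = X} {Y} {y} X⊆Y y∈Y y∉X =
  Unique⇒length≤ (y∉alphX ∷ deduplicate-! _≟_ X) y∷alphX⊆alphY
  where
  y∉alphX : All (y ≢_) (deduplicate _≟_ X)
  y∉alphX = All.tabulate λ z∈ y≡z → y∉X (subst (_∈ X) (sym y≡z) (∈-deduplicate⁻ _≟_ X z∈))
  y∷alphX⊆alphY : y ∷ deduplicate _≟_ X ⊆ deduplicate _≟_ Y
  y∷alphX⊆alphY (here refl) = ∈-deduplicate⁺ _≟_ y∈Y
  y∷alphX⊆alphY (there z∈)  = ∈-deduplicate⁺ _≟_ (X⊆Y (∈-deduplicate⁻ _≟_ X z∈))

alphSize-map : {f : Fin σ → Fin σ} {X : List (Fin σ)} → InjectiveOn f X → alphSize (map f X) ≡ alphSize X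
alphSize-map {f = f} {X} inj = ≤-antisym
  (≤-trans (Unique⇒length≤ (deduplicate-! _≟_ (map f X)) alph[fX]⊆f[alphX]) (≤-reflexive (length-map f alphX)))
  (≤-trans (≤-reflexive (sym (length-map f alphX))) (Unique⇒length≤ unique-f[alphX] f[alphX]⊆alph[fX]))
  where
  alphX : List (Fin _)
  alphX = deduplicate _≟_ X
  unique-f[alphX] : Unique (map f alphX)
  unique-f[alphX] = Unique-map⁺ (InjectiveOn-⊆ (∈-deduplicate⁻ _≟_ X) inj) (deduplicate-! _≟_ X)
  alph[fX]⊆f[alphX] : deduplicate _≟_ (map f X) ⊆ map f alphX
  alph[fX]⊆f[alphX] y∈ with x , x∈ , refl ← ∈-map⁻ f (∈-deduplicate⁻ _≟_ (map f X) y∈) =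
    ∈-map⁺ f (∈-deduplicate⁺ _≟_ x∈)
  f[alphX]⊆alph[fX] : map f alphX ⊆ deduplicate _≟_ (map f X)
  f[alphX]⊆alph[fX] y∈ with x , x∈ , refl ← ∈-map⁻ f y∈ =
    ∈-deduplicate⁺ _≟_ (∈-map⁺ f (∈-deduplicate⁻ _≟_ X x∈))

-- Parameterized matching

infix 4 _≈ₚ_

_≈ₚ_ : List (Fin σ) → List (Fin σ) → Set
_≈ₚ_ {σ} X Y = Σ (Fin σ → Fin σ) λ f → InjectiveOn f X × map f X ≡ Y

≈ₚ⇒PMatch : {X Y : List (Fin σ)} → X ≈ₚ Y → PMatch X Y
≈ₚ⇒PMatch {X = X} (f , inj , refl) = sym (length-map f X) , f , inj , pointwise X
  where
  pointwise : (Z : List _) → Pointwise (λ x y → f x ≡ y) Z (map f Z)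
  pointwise []      = []
  pointwise (z ∷ Z) = refl ∷ pointwise Z

PMatch⇒≈ₚ : {X Y : List (Fin σ)} → PMatch X Y → X ≈ₚ Y
PMatch⇒≈ₚ {Y = Y} (_ , f , inj , fX∼Y) = f , inj , trans (Pointwise-≡⇒≡ (map⁺ f id fX∼Y)) (map-id Y)

≈ₚ-refl : {X : List (Fin σ)} → X ≈ₚ X
≈ₚ-refl {X = X} = id , (λ _ _ _ _ x≡y → x≡y) , map-id X

≈ₚ-reverse : {X Y : List (Fin σ)} → X ≈ₚ Y → reverse X ≈ₚ reverse Y
≈ₚ-reverse {X = X} (f , inj , refl) = f , InjectiveOn-⊆ reverse⁻ inj , reverse-map f X

≈ₚ-++⁻ : {X X′ Y Y′ : List (Fin σ)} → length X ≡ length Y →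
         X ++ X′ ≈ₚ Y ++ Y′ → X ≈ₚ Y × X′ ≈ₚ Y′
≈ₚ-++⁻ {X = X} {X′} {Y} |X|≡|Y| (f , inj , fXX′≡YY′)
  with fX≡Y , fX′≡Y′ ← ++-cancel-length (map f X) Y (trans (length-map f X) |X|≡|Y|)
                                        (trans (sym (map-++ f X X′)) fXX′≡YY′) =
  (f , InjectiveOn-⊆ ∈-++⁺ˡ inj , fX≡Y) , (f , InjectiveOn-⊆ (∈-++⁺ʳ X) inj , fX′≡Y′)

≈ₚ⇒PSquare : {X Y : List (Fin σ)} → X ≈ₚ Y → PSquare (X ++ Y)
≈ₚ⇒PSquare {X = X} {Y} X≈Y = X , Y , refl , proj₁ (≈ₚ⇒PMatch X≈Y) , ≈ₚ⇒PMatch X≈Y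

PSquare-halves : {X Y : List (Fin σ)} → length X ≡ length Y → PSquare (X ++ Y) → X ≈ₚ Y
PSquare-halves {X = X} {Y} |X|≡|Y| (X′ , Y′ , XY≡X′Y′ , |X′|≡|Y′| , X′≈Y′)
  = subst₂ _≈ₚ_ (sym (proj₁ halves-agree)) (sym (proj₂ halves-agree)) (PMatch⇒≈ₚ X′≈Y′)
  where
  open ≡-Reasoning
  double : length X + length X ≡ length X′ + length X′
  double = begin
    length X + length X    ≡⟨ cong (length X +_) |X|≡|Y| ⟩
    length X + length Y    ≡⟨ length-++ X ⟨
    length (X ++ Y)        ≡⟨ cong length XY≡X′Y′ ⟩
    length (X′ ++ Y′)      ≡⟨ length-++ X′ ⟩
    length X′ + length Y′  ≡⟨ cong (length X′ +_) |X′|≡|Y′| ⟨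
    length X′ + length X′  ∎
  |X|≡|X′| : length X ≡ length X′
  |X|≡|X′| = trans (n≡⌊n+n/2⌋ (length X)) (trans (cong ⌊_/2⌋ double) (sym (n≡⌊n+n/2⌋ (length X′))))
  halves-agree : X ≡ X′ × Y ≡ Y′
  halves-agree = ++-cancel-length X X′ |X|≡|X′| XY≡X′Y′

-- The encoding E

avoids? : (c : Fin σ) → Decidable (_≢ c)
avoids? c a = ¬? (a ≟ c)

∉⇒All≢ : {c : Fin σ} {W : List (Fin σ)} → c ∉ W → All (_≢ c) W
∉⇒All≢ {W = W} c∉W = All.tabulate λ a∈W a≡c → c∉W (subst (_∈ W) a≡c a∈W)

first-occurrence : {c : Fin σ} {L : List (Fin σ)} → c ∈ L → ∃₂ λ W R → L ≡ W ++ c ∷ R × c ∉ W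
first-occurrence {c = c} {x ∷ L} c∈L with x ≟ c
... | yes refl = [] , L , refl , λ ()
first-occurrence (here refl) | no x≢c = contradiction refl x≢c
first-occurrence {c = c} {x ∷ L} (there c∈L) | no x≢c with W , R , refl , c∉W ← first-occurrence c∈L =
  x ∷ W , R , refl , λ { (here c≡x) → x≢c (sym c≡x) ; (there c∈W) → c∉W c∈W }

E-++-∷ʳ : (P Z : List (Fin σ)) (c : Fin σ) → E (P ++ Z ++ [ c ]) ≡ Erev (c ∷ Z ʳ++ reverse P)
E-++-∷ʳ P Z c = trans (cong Erev (++-ʳ++ P)) (cong Erev (++-ʳ++ Z))

E-reverse : (L : List (Fin σ)) → E (reverse L) ≡ Erev L
E-reverse L = cong Erev (reverse-involutive L)

Erev-first : {c : Fin σ} {W : List (Fin σ)} (R : List (Fin σ)) → c ∉ W → Erev (c ∷ W ++ c ∷ R) ≡ alphSize W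
Erev-first {c = c} {W} R c∉W = cong alphSize (begin
  takeWhile (avoids? c) (W ++ c ∷ R)   ≡⟨ takeWhile-++ (avoids? c) (c ∷ R) (∉⇒All≢ c∉W) ⟩
  W ++ takeWhile (avoids? c) (c ∷ R)   ≡⟨ cong (W ++_) (takeWhile-¬ (avoids? c) R (λ c≢c → c≢c refl)) ⟩
  W ++ []                              ≡⟨ ++-identityʳ W ⟩
  W                                    ∎)
  where open ≡-Reasoning

Erev-first-++ : {c : Fin σ} {W : List (Fin σ)} (R r : List (Fin σ)) → c ∉ W →
                Erev (c ∷ (W ++ c ∷ R) ++ r) ≡ alphSize W
Erev-first-++ {c = c} {W} R r c∉W =
  trans (cong (λ L → Erev (c ∷ L)) (++-assoc W (c ∷ R) r)) (Erev-first (R ++ r) c∉W)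

alphSize≤Erev : {c : Fin σ} {A : List (Fin σ)} (r : List (Fin σ)) → c ∉ A → alphSize A ≤ Erev (c ∷ A ++ r)
alphSize≤Erev {c = c} {A} r c∉A = alphSize-mono A⊆prefix
  where
  A⊆prefix : A ⊆ takeWhile (avoids? c) (A ++ r)
  A⊆prefix a∈A = subst (_ ∈_) (sym (takeWhile-++ (avoids? c) r (∉⇒All≢ c∉A))) (∈-++⁺ˡ a∈A)

Erev<alphSize : {c : Fin σ} {A : List (Fin σ)} (r : List (Fin σ)) → c ∈ A → Erev (c ∷ A ++ r) < alphSize A
Erev<alphSize {c = c} r c∈A with W , R , refl , c∉W ← first-occurrence c∈A = begin-strict
  Erev (c ∷ (W ++ c ∷ R) ++ r)   ≡⟨ Erev-first-++ R r c∉W ⟩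
  alphSize W                     <⟨ alphSize-strict ∈-++⁺ˡ (∈-++⁺ʳ W (here refl)) c∉W ⟩
  alphSize (W ++ c ∷ R)          ∎
  where open ≤-Reasoning

Erev-injective : {x y : Fin σ} {L : List (Fin σ)} → x ∈ L → Erev (x ∷ L) ≡ Erev (y ∷ L) → x ≡ y
Erev-injective {x = x} {y} x∈L eq with W , R , refl , x∉W ← first-occurrence x∈L =
  separate (trans (sym (Erev-first R x∉W)) eq)
  where
  alphSize<Erev : y ≢ x → y ∉ W → alphSize W < Erev (y ∷ W ++ x ∷ R)
  alphSize<Erev y≢x y∉W = begin-strict
    alphSize W                    <⟨ alphSize-strict {Y = W ++ [ x ]} ∈-++⁺ˡ (∈-++⁺ʳ W (here refl)) x∉W ⟩
    alphSize (W ++ [ x ])         ≤⟨ alphSize≤Erev R y∉Wx ⟩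
    Erev (y ∷ (W ++ [ x ]) ++ R)  ≡⟨ cong (λ L → Erev (y ∷ L)) (++-assoc W [ x ] R) ⟩
    Erev (y ∷ W ++ x ∷ R)         ∎
    where
    open ≤-Reasoning
    y∉Wx : y ∉ W ++ [ x ]
    y∉Wx y∈ with ∈-++⁻ W y∈
    ... | inj₁ y∈W        = y∉W y∈W
    ... | inj₂ (here y≡x) = y≢x y≡x
  separate : alphSize W ≡ Erev (y ∷ W ++ x ∷ R) → x ≡ y
  separate |W|≡ with y ≟ x | any? (y ≟_) W
  ... | yes y≡x | _       = sym y≡x
  ... | no _    | yes y∈W = contradiction (Erev<alphSize (x ∷ R) y∈W) (<-irrefl (sym |W|≡))
  ... | no y≢x  | no y∉W  = contradiction (alphSize<Erev y≢x y∉W) (<-irrefl |W|≡)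

Erev-map : {f : Fin σ → Fin σ} {c : Fin σ} {A : List (Fin σ)} (r₁ r₂ : List (Fin σ)) →
           InjectiveOn f A → c ∈ A → Erev (f c ∷ map f A ++ r₂) ≡ Erev (c ∷ A ++ r₁)
Erev-map {f = f} {c} r₁ r₂ inj c∈A with W , R , refl , c∉W ← first-occurrence c∈A = begin
  Erev (f c ∷ map f (W ++ c ∷ R) ++ r₂)          ≡⟨ cong (λ L → Erev (f c ∷ L ++ r₂)) (map-++ f W (c ∷ R)) ⟩
  Erev (f c ∷ (map f W ++ f c ∷ map f R) ++ r₂)  ≡⟨ Erev-first-++ (map f R) r₂ fc∉fW ⟩
  alphSize (map f W)                             ≡⟨ alphSize-map {X = W} (InjectiveOn-⊆ ∈-++⁺ˡ inj) ⟩
  alphSize W                                     ≡⟨ Erev-first-++ R r₁ c∉W ⟨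
  Erev (c ∷ (W ++ c ∷ R) ++ r₁)                  ∎
  where
  open ≡-Reasoning
  fc∉fW : f c ∉ map f W
  fc∉fW fc∈fW with w , w∈W , fc≡fw ← ∈-map⁻ f fc∈fW =
    c∉W (subst (_∈ W) (sym (inj c w (∈-++⁺ʳ W (here refl)) (∈-++⁺ˡ w∈W) fc≡fw)) w∈W)

≈ₚ-∷-fresh : {f : Fin σ → Fin σ} {c d : Fin σ} {A : List (Fin σ)} →
             InjectiveOn f A → c ∉ A → d ∉ map f A → c ∷ A ≈ₚ d ∷ map f A
≈ₚ-∷-fresh {f = f} {c} {d} {A} inj c∉A d∉fA = g , InjectiveOn-∷ inj-g gc∉gA , cong₂ _∷_ gc≡d gA≡fA
  where
  g : Fin _ → Fin _
  g = updateAt f c (λ _ → d)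
  gc≡d : g c ≡ d
  gc≡d = updateAt-updates c f
  g≗f : All (λ a → g a ≡ f a) A
  g≗f = All.tabulate λ {a} a∈A → updateAt-minimal a c f (λ a≡c → c∉A (subst (_∈ A) a≡c a∈A))
  gA≡fA : map g A ≡ map f A
  gA≡fA = map-cong-local g≗f
  inj-g : InjectiveOn g A
  inj-g a b a∈A b∈A ga≡gb =
    inj a b a∈A b∈A (trans (sym (All.lookup g≗f a∈A)) (trans ga≡gb (All.lookup g≗f b∈A)))
  gc∉gA : g c ∉ map g A
  gc∉gA = subst₂ _∉_ (sym gc≡d) (sym gA≡fA) d∉fA

extend : {A B : List (Fin σ)} {c d : Fin σ} (r₁ r₂ : List (Fin σ)) → A ≈ₚ B →
         Erev (c ∷ A ++ r₁) ≡ Erev (d ∷ B ++ r₂) → c ∷ A ≈ₚ d ∷ B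
extend {A = A} {c = c} {d} r₁ r₂ (f , inj , refl) eq with any? (c ≟_) A
... | yes c∈A = f , InjectiveOn-⊆ c∷A⊆A inj , cong (_∷ map f A) fc≡d
  where
  c∷A⊆A : c ∷ A ⊆ A
  c∷A⊆A (here refl) = c∈A
  c∷A⊆A (there a∈A) = a∈A
  fc≡d : f c ≡ d
  fc≡d = Erev-injective (∈-++⁺ˡ (∈-map⁺ f c∈A)) (trans (Erev-map r₁ r₂ inj c∈A) eq)
... | no c∉A = ≈ₚ-∷-fresh inj c∉A d∉fA
  where
  open ≤-Reasoning
  d∉fA : d ∉ map f A
  d∉fA d∈fA = <-irrefl refl (begin-strict
    Erev (c ∷ A ++ r₁)        ≡⟨ eq ⟩
    Erev (d ∷ map f A ++ r₂)  <⟨ Erev<alphSize r₂ d∈fA ⟩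
    alphSize (map f A)        ≡⟨ alphSize-map inj ⟩
    alphSize A                ≤⟨ alphSize≤Erev r₁ c∉A ⟩
    Erev (c ∷ A ++ r₁)        ∎)

extendʳ : {X Y : List (Fin σ)} {c d : Fin σ} (r₁ r₂ : List (Fin σ)) → X ≈ₚ Y →
          Erev (c ∷ X ʳ++ r₁) ≡ Erev (d ∷ Y ʳ++ r₂) → X ++ [ c ] ≈ₚ Y ++ [ d ]
extendʳ {X = X} {Y} {c} {d} r₁ r₂ X≈Y eq =
  subst₂ _≈ₚ_ (reverse-∷-reverse c X) (reverse-∷-reverse d Y)
              (≈ₚ-reverse (extend r₁ r₂ (≈ₚ-reverse X≈Y) eq′))
  where
  eq′ : Erev (c ∷ reverse X ++ r₁) ≡ Erev (d ∷ reverse Y ++ r₂)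
  eq′ = subst₂ (λ L M → Erev (c ∷ L) ≡ Erev (d ∷ M)) (ʳ++-defn X) (ʳ++-defn Y) eq
  reverse-∷-reverse : (z : Fin _) (Z : List (Fin _)) → reverse (z ∷ reverse Z) ≡ Z ++ [ z ]
  reverse-∷-reverse z Z = trans (unfold-reverse z (reverse Z)) (cong (_++ [ z ]) (reverse-involutive Z))

data Window {A : Set} (l : ℕ) : List A → Set where
  window : (a : A) (X : List A) (b : A) (Y : List A) (c : A) (R : List A) →
           length X ≡ l → length Y ≡ l → Window l (a ∷ X ++ b ∷ Y ++ c ∷ R)

window-of-length : {l r : ℕ} (u : List A) → length u ≡ suc (l + suc (l + suc r)) → Window l u
window-of-length {l = l} (a ∷ u) |u| with splitAt-length l u (suc-injective |u|)
... | X , []    , _    , _   , ()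
... | X , b ∷ v , refl , |X| , |bv| with splitAt-length l v (suc-injective |bv|)
...   | Y , []    , _    , _   , ()
...   | Y , c ∷ R , refl , |Y| , _ = window a X b Y c R |X| |Y|

window? : (l : ℕ) (u : List A) → suc l + suc l < length u → Window l u
window? l u 2l+2<|u| with r , |u|≡ ← m≤n⇒∃[o]m+o≡n 2l+2<|u| =
  window-of-length u (trans (sym |u|≡) (regroup l r))
  where
  regroup : ∀ l r → suc (suc l + suc l) + r ≡ suc (l + suc (l + suc r))
  regroup = solve-∀

module WindowProperties {A : Set} {l : ℕ} (a : A) (X : List A) (b : A) (Y : List A) (c : A) (R : List A)
                        (|X| : length X ≡ l) (|Y| : length Y ≡ l) where

  private
    take-through-c : take (l + suc (l + 1)) (X ++ b ∷ Y ++ c ∷ R) ≡ X ++ b ∷ Y ++ [ c ]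
    take-through-c = trans (take-++ X (suc (l + 1)) _ |X|) (cong (λ Z → X ++ b ∷ Z) (take-++ Y 1 _ |Y|))

    regroup : ∀ l → suc l + suc l ≡ l + suc (l + 1)
    regroup = solve-∀

  take-window : take (suc l + suc l) (a ∷ X ++ b ∷ Y ++ c ∷ R) ≡ (a ∷ X) ++ (b ∷ Y)
  take-window = cong (a ∷_) (trans (take-++ X (suc l) _ |X|) (cong (λ Z → X ++ b ∷ Z) (take-length-++ Y _ |Y|)))

  take-window-tail : take (suc l + suc l) (X ++ b ∷ Y ++ c ∷ R) ≡ (X ++ [ b ]) ++ (Y ++ [ c ])
  take-window-tail = trans (cong (λ k → take k (X ++ b ∷ Y ++ c ∷ R)) (regroup l))
                           (trans take-through-c (sym (++-assoc X [ b ] _)))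

  take-to-middle : take (suc l + 1) (a ∷ X ++ b ∷ Y ++ c ∷ R) ≡ a ∷ X ++ [ b ]
  take-to-middle = cong (a ∷_) (take-++ X 1 _ |X|)

  take-to-end : take (suc l + suc l + 1) (a ∷ X ++ b ∷ Y ++ c ∷ R) ≡ (a ∷ X ++ b ∷ Y) ++ [ c ]
  take-to-end = cong (a ∷_) (trans (cong (λ k → take k (X ++ b ∷ Y ++ c ∷ R)) (+-assoc l (suc l) 1))
                                   (trans take-through-c (sym (++-assoc X (b ∷ Y) [ c ]))))

  drop-to-middle : drop (suc l) (a ∷ X ++ b ∷ Y ++ c ∷ R) ≡ b ∷ Y ++ c ∷ R
  drop-to-middle = drop-length-++ X _ |X|

PSquare-shiftʳ : (P u : List (Fin σ)) (ℓ : ℕ) → ℓ + ℓ < length u → PSquare (take (ℓ + ℓ) u) →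
                 E (P ++ take (ℓ + 1) u) ≡ E (P ++ take (ℓ + ℓ + 1) u) → PSquare (take (ℓ + ℓ) (drop 1 u))
PSquare-shiftʳ P u zero    _       _      _  = ≈ₚ⇒PSquare (≈ₚ-refl {X = []})
PSquare-shiftʳ P u (suc l) 2ℓ<|u| square eq with window? l u 2ℓ<|u|
... | window a X b Y c R |X| |Y| = subst PSquare (sym take-window-tail) (≈ₚ⇒PSquare (extendʳ _ _ X≈Y eq′))
  where
  open WindowProperties a X b Y c R |X| |Y|
  open ≡-Reasoning
  X≈Y : X ≈ₚ Y
  X≈Y = proj₂ (≈ₚ-++⁻ {X = [ a ]} {Y = [ b ]} refl
                (PSquare-halves (cong suc (trans |X| (sym |Y|))) (subst PSquare take-window square)))
  eq′ : Erev (b ∷ X ʳ++ a ∷ reverse P) ≡ Erev (c ∷ Y ʳ++ b ∷ X ʳ++ a ∷ reverse P)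
  eq′ = begin
    Erev (b ∷ X ʳ++ a ∷ reverse P)                       ≡⟨ E-++-∷ʳ P (a ∷ X) b ⟨
    E (P ++ a ∷ X ++ [ b ])                              ≡⟨ cong (λ Z → E (P ++ Z)) take-to-middle ⟨
    E (P ++ take (suc l + 1) (a ∷ X ++ b ∷ Y ++ c ∷ R))   ≡⟨ eq ⟩
    E (P ++ take (suc l + suc l + 1) (a ∷ X ++ b ∷ Y ++ c ∷ R)) ≡⟨ cong (λ Z → E (P ++ Z)) take-to-end ⟩
    E (P ++ (a ∷ X ++ b ∷ Y) ++ [ c ])                   ≡⟨ E-++-∷ʳ P (a ∷ X ++ b ∷ Y) c ⟩
    Erev (c ∷ (X ++ b ∷ Y) ʳ++ a ∷ reverse P)            ≡⟨ cong (λ L → Erev (c ∷ L)) (++-ʳ++ X) ⟩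
    Erev (c ∷ Y ʳ++ b ∷ X ʳ++ a ∷ reverse P)             ∎

PSquare-shiftˡ : (u : List (Fin σ)) (ℓ : ℕ) → ℓ + ℓ < length u → PSquare (take (ℓ + ℓ) (drop 1 u)) →
                 Erev u ≡ Erev (drop ℓ u) → PSquare (take (ℓ + ℓ) u)
PSquare-shiftˡ u zero    _       _      _  = ≈ₚ⇒PSquare (≈ₚ-refl {X = []})
PSquare-shiftˡ u (suc l) 2ℓ<|u| square eq with window? l u 2ℓ<|u|
... | window e X x Y y R |X| |Y| =
  subst PSquare (sym take-window) (≈ₚ⇒PSquare (extend _ _ X≈Y (trans eq (cong Erev drop-to-middle))))
  where
  open WindowProperties e X x Y y R |X| |Y|
  |Xx|≡|Yy| : length (X ++ [ x ]) ≡ length (Y ++ [ y ])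
  |Xx|≡|Yy| = trans (length-++ X) (trans (cong (_+ 1) (trans |X| (sym |Y|))) (sym (length-++ Y)))
  X≈Y : X ≈ₚ Y
  X≈Y = proj₁ (≈ₚ-++⁻ (trans |X| (sym |Y|)) (PSquare-halves |Xx|≡|Yy| (subst PSquare take-window-tail square)))

-- Fragments T[a .. b)

fac-take-drop : (t : List (Fin σ)) (a m : ℕ) → fac t (suc a) (suc (a + m)) ≡ take m (drop a t)
fac-take-drop t a m = cong (λ k → take k (drop a t)) (m+n∸m≡n a m)

fac-drop-suc : (t : List (Fin σ)) (p m : ℕ) → fac t (suc (suc p)) (suc (suc p + m)) ≡ take m (drop 1 (drop p t))
fac-drop-suc t p m = trans (fac-take-drop t (suc p) m) (cong (take m) (drop-suc p t))

fac-prefix : (t : List (Fin σ)) (p m : ℕ) → fac t 1 (suc p + m + 1) ≡ take p t ++ take (m + 1) (drop p t)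
fac-prefix t p m = trans (cong (λ k → take k t) (+-assoc p m 1)) (take-+ p (m + 1) t)

fac-suffix : (t : List (Fin σ)) (a : ℕ) → fac t (suc a) (length t + 1) ≡ drop a t
fac-suffix t a = trans (cong (λ k → take (k ∸ suc a) (drop a t)) (+-comm (length t) 1))
                       (take-all _ (drop a t) (≤-reflexive (length-drop a t)))

<-length-drop : (p m : ℕ) (t : List A) → suc p + m ≤ length t → m < length (drop p t)
<-length-drop p m t le =
  subst (suc m ≤_) (sym (length-drop p t))
        (m+n≤o⇒m≤o∸n (suc m) (subst (_≤ length t) (cong suc (+-comm p m)) le))

PSquare-fac-shiftʳ : (t : List (Fin σ)) {n : ℕ} (p ℓ : ℕ) → length t ≡ n → suc p + (ℓ + ℓ) ≤ n →
  PSquare (fac t (suc p) (suc p + (ℓ + ℓ))) →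
  E (fac t 1 (suc p + ℓ + 1)) ≡ E (fac t 1 (suc p + (ℓ + ℓ) + 1)) →
  PSquare (fac t (suc p + 1) (suc p + (ℓ + ℓ) + 1))
PSquare-fac-shiftʳ t p ℓ refl le square eq = subst PSquare (sym fac-shifted)
  (PSquare-shiftʳ (take p t) (drop p t) ℓ (<-length-drop p (ℓ + ℓ) t le)
    (subst PSquare (fac-take-drop t p (ℓ + ℓ)) square)
    (subst₂ (λ L M → E L ≡ E M) (fac-prefix t p ℓ) (fac-prefix t p (ℓ + ℓ)) eq))
  where
  fac-shifted : fac t (suc p + 1) (suc p + (ℓ + ℓ) + 1) ≡ take (ℓ + ℓ) (drop 1 (drop p t))
  fac-shifted = trans (cong₂ (fac t) (+-comm (suc p) 1) (+-comm (suc p + (ℓ + ℓ)) 1)) (fac-drop-suc t p (ℓ + ℓ))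

PSquare-fac-shiftˡ : (t : List (Fin σ)) {n : ℕ} (k ℓ : ℕ) → length t ≡ n → suc (suc k) + (ℓ + ℓ) ≤ n + 1 →
  PSquare (fac t (suc (suc k)) (suc (suc k) + (ℓ + ℓ))) →
  E (reverse (fac t (suc k) (n + 1))) ≡ E (reverse (fac t (suc (k + ℓ)) (n + 1))) →
  PSquare (fac t (suc k) (suc (k + (ℓ + ℓ))))
PSquare-fac-shiftˡ t k ℓ refl le square eq = subst PSquare (sym (fac-take-drop t k (ℓ + ℓ)))
  (PSquare-shiftˡ (drop k t) ℓ (<-length-drop k (ℓ + ℓ) t le′)
    (subst PSquare (fac-drop-suc t k (ℓ + ℓ)) square)
    eq′)
  where
  le′ : suc k + (ℓ + ℓ) ≤ length t
  le′ = ≤-pred (subst (suc (suc k) + (ℓ + ℓ) ≤_) (+-comm (length t) 1) le)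
  open ≡-Reasoning
  eq′ : Erev (drop k t) ≡ Erev (drop ℓ (drop k t))
  eq′ = begin
    Erev (drop k t)                                     ≡⟨ E-reverse (drop k t) ⟨
    E (reverse (drop k t))                              ≡⟨ cong (E ∘ reverse) (fac-suffix t k) ⟨
    E (reverse (fac t (suc k) (length t + 1)))          ≡⟨ eq ⟩
    E (reverse (fac t (suc (k + ℓ)) (length t + 1)))    ≡⟨ cong (E ∘ reverse) (fac-suffix t (k + ℓ)) ⟩
    E (reverse (drop (k + ℓ) t))                        ≡⟨ E-reverse (drop (k + ℓ) t) ⟩
    Erev (drop (k + ℓ) t)                               ≡⟨ cong Erev (drop-drop k ℓ t) ⟨
    Erev (drop ℓ (drop k t))                            ∎

lemma21 : {σ n : ℕ} (T : Vec (Fin σ) n) (i ℓ : ℕ) →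
    (1 ≤ i → i + (ℓ + ℓ) ≤ n →
      PSquare (fac (toList T) i (i + (ℓ + ℓ))) →
      arrowR T (i + ℓ) ≡ arrowR T (i + (ℓ + ℓ)) →
      PSquare (fac (toList T) (i + 1) (i + (ℓ + ℓ) + 1)))
    ×
    (2 ≤ i → i + (ℓ + ℓ) ≤ n + 1 →
      PSquare (fac (toList T) i (i + (ℓ + ℓ))) →
      arrowL T (i ∸ 1) ≡ arrowL T (i + ℓ ∸ 1) →
      PSquare (fac (toList T) (i ∸ 1) (i + (ℓ + ℓ) ∸ 1)))
lemma21 T zero          ℓ = (λ ()) , (λ ())
lemma21 T (suc zero)    ℓ = (λ _ → PSquare-fac-shiftʳ (toList T) 0 ℓ (length-toList T)) , (λ { (s≤s ()) })
lemma21 T (suc (suc k)) ℓ = (λ _ → PSquare-fac-shiftʳ (toList T) (suc k) ℓ (length-toList T))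
                          , (λ _ → PSquare-fac-shiftˡ (toList T) k ℓ (length-toList T))
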